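{- Let $D$ be a finite domain with $\{0,1\} \subseteq D$, and let $P \subsetneq Q \subseteq D^r$ with $P$ nonempty. Define $R \subsetneq S \subseteq D^{2r}$ by $R \mid S = (P \mid Q) \boxtimes (\operatorname{OR}_r \mid \{0,1\}^r)$, i.e. $S = Q \times \{0,1\}^r$ and $R = (P \times \{0,1\}^r) \cup (Q \times \operatorname{OR}_r)$. Then $\operatorname{NRD}(R, n) = \Theta_r(\operatorname{NRD}(P \mid Q, n) \cdot n^r)$, where $\Theta_r$ hides a factor depending only on $r$.
   Context: $\operatorname{OR}_r = \{0,1\}^r \setminus \{0^r\}$. The box product of $P_1 \subsetneq Q_1 \subseteq D^{r_1}$ and $P_2 \subsetneq Q_2 \subseteq D^{r_2}$ is $P_3 \mid Q_3$ with $Q_3 = Q_1 \times Q_2$ and $P_3 = (P_1 \times Q_2)\cup(Q_1 \times P_2)$ (concatenating tuples). An instance is a hypergraph $H=(V,E)$ with $E \subseteq V^r$ (ordered tuples). For $P \subsetneq Q \subseteq D^r$, $H$ is a non-redundant instance of $\operatorname{CSP}(P\mid Q)$ if for every $e\in E$ there is $\psi_e : V\to D$ with $\psi_e(e')\in P$ for all $e'\neq e$ and $\psi_e(e)\in Q\setminus P$; $\operatorname{NRD}(P\mid Q,n)$ is the maximum number of edges of such an instance on $n$ vertices. $\operatorname{NRD}(R,n) := \operatorname{NRD}(R \mid D^{2r}, n)$, i.e. for each edge some assignment satisfies all other edges (lands in $R$) but not that edge. -}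

module Defs where

open import Data.Nat using (ℕ; zero; suc; _+_; _*_; _^_; _≤_)
open import Data.Fin using (Fin; zero; suc)
open import Data.Bool using (Bool; true; false; _∧_; _∨_; not; T)
open import Data.Vec using (Vec; map; take; drop; toList)
open import Data.List using (List; length)
open import Data.Bool.ListAction using (all; any)
open import Data.List.Relation.Unary.Unique.Propositional using (Unique)
open import Data.List.Membership.Propositional using (_∈_)
open import Data.Product using (Σ; _×_; ∃)
open import Relation.Binary.PropositionalEquality using (_≡_; _≢_)
open import Relation.Nullary using (¬_)

-- The domain D is Fin (2 + k); the elements 0 and 1 of D are
-- Fin.zero and Fin.suc Fin.zero.  A relation of arity r over D is a
-- subset of D^r, given by its (Boolean) characteristic function.
Rel : ℕ → ℕ → Set
Rel k r = Vec (Fin k) r → Bool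

_⊊_ : ∀ {k r} → Rel k r → Rel k r → Set
P ⊊ Q = (∀ x → T (P x) → T (Q x)) × ∃ λ x → T (Q x) × ¬ T (P x)

NonEmpty : ∀ {k r} → Rel k r → Set
NonEmpty P = ∃ λ x → T (P x)

isZero : ∀ {k} → Fin (suc (suc k)) → Bool
isZero zero = true
isZero (suc _) = false

isOne : ∀ {k} → Fin (suc (suc k)) → Bool
isOne (suc zero) = true
isOne _ = false

Bin : ∀ {k} r → Rel (suc (suc k)) r
Bin r x = all (λ d → isZero d ∨ isOne d) (toList x)

OR : ∀ {k} r → Rel (suc (suc k)) r
OR r x = Bin r x ∧ any isOne (toList x)

Full : ∀ {k} r → Rel k r
Full r _ = true

-- Box product (P₁ | Q₁) ⊠ (P₂ | Q₂) = P₃ | Q₃ (tuples concatenated)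
boxP : ∀ {k r₁ r₂} → Rel k r₁ → Rel k r₁ → Rel k r₂ → Rel k r₂ → Rel k (r₁ + r₂)
boxP {r₁ = r₁} P₁ Q₁ P₂ Q₂ v =
  (P₁ (take r₁ v) ∧ Q₂ (drop r₁ v)) ∨ (Q₁ (take r₁ v) ∧ P₂ (drop r₁ v))

boxQ : ∀ {k r₁ r₂} → Rel k r₁ → Rel k r₁ → Rel k r₂ → Rel k r₂ → Rel k (r₁ + r₂)
boxQ {r₁ = r₁} P₁ Q₁ P₂ Q₂ v = Q₁ (take r₁ v) ∧ Q₂ (drop r₁ v)

record Instance (n r : ℕ) : Set where
  constructor mkInstance
  field
    edges    : List (Vec (Fin n) r)
    distinct : Unique edges
open Instance public

NonRedundant : ∀ {k r n} → Rel k r → Rel k r → Instance n r → Set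
NonRedundant {k} {r} {n} P Q H =
  ∀ e → e ∈ edges H →
    Σ (Fin n → Fin k) λ ψ →
      (∀ e' → e' ∈ edges H → e' ≢ e → T (P (map ψ e')))
      × T (Q (map ψ e)) × ¬ T (P (map ψ e))

IsNRD : ∀ {k r} → Rel k r → Rel k r → ℕ → ℕ → Set
IsNRD {k} {r} P Q n m =
  (Σ (Instance n r) λ H → NonRedundant P Q H × length (edges H) ≡ m)
  × (∀ (H : Instance n r) → NonRedundant P Q H → length (edges H) ≤ m)

{-# OPTIONS --safe #-}
-- Write an edge of an R-instance as g = e ++ f, with e its P|Q half and f its OR half, and fix
-- a witness ψ_g for every edge g.  Upper bound: if ψ_g(f) is not Boolean, g is the only edge
-- with OR half f; if ψ_g(f) is Boolean but ψ_g(e) ∉ Q, g is the only edge with P|Q half e;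
-- otherwise ψ_g(f) = 0^r and ψ_g(e) ∈ Q ∖ P, and for each f the P|Q halves of these edges
-- form a non-redundant P|Q-instance.  Hence NRD(R) ≤ (2 + NRD(P|Q)) n^r.
-- Lower bound: split (r+1) r L ≤ n vertices into r+1 groups of r blocks of size L.  Each edge
-- e of a non-redundant P|Q-instance misses some group j, and the edges e ++ f with e missing j
-- and f taking one vertex from each block of group j form a non-redundant R-instance: for
-- e ++ f use ψ_e off group j, and on group j the value 0 at the vertices of f and 1 elsewhere.
-- Summing over j gives NRD(P|Q) L^r ≤ (r+1) NRD(R), and L = ⌊n / ((r+1) r)⌋ ≥ n / (2 (r+1) r).
module Submission where

open import Defs
open import Data.Nat using (ℕ; zero; suc; _+_; _*_; _^_; _≤_; _<_; z≤n; NonZero)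
open import Data.Nat.Properties
open import Data.Nat.DivMod using (_/_; _%_; m/n*n≤m; m≡m%n+[m/n]*n; m%n≤n; m≥n⇒m/n>0)
open import Data.Nat.ListAction using (sum)
open import Data.Nat.Solver using (module +-*-Solver)
open import Data.Fin using (Fin; zero; suc; combine; remQuot; inject≤)
import Data.Fin.Properties as Finₚ
open import Data.Bool using (T; _∧_; _∨_)
open import Data.Bool.Properties using (T?; T-∧; T-∨)
open import Data.Bool.ListAction using (any)
open import Data.Vec as Vec using (Vec; []; _∷_; _++_; take; drop; toList; lookup; tabulate)
import Data.Vec.Properties as Vecₚ
open import Data.List as List using (List; []; _∷_; [_]; length; filter; allFin; cartesianProductWith)
import Data.List.Properties as Listₚ
open import Data.List.Relation.Unary.Any as Any using (Any; here; there)
open import Data.List.Relation.Unary.All as All using (All)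
import Data.List.Relation.Unary.All.Properties as Allₚ
open import Data.List.Relation.Unary.AllPairs using ([]; _∷_)
open import Data.List.Relation.Unary.Unique.Propositional using (Unique)
import Data.List.Relation.Unary.Unique.Propositional.Properties as Uniqueₚ
open import Data.List.Membership.Propositional using (_∈_; lose)
open import Data.List.Membership.Propositional.Properties
  using (∈-filter⁻; ∈-map⁻; ∈-allFin; ∈-cartesianProductWith⁺; ∈-cartesianProductWith⁻)
import Data.List.Membership.DecPropositional as DecMembership
open import Data.Product using (Σ; _×_; _,_; ∃; proj₁; proj₂; uncurry)
open import Data.Sum as Sum using (_⊎_; inj₁; inj₂)
open import Data.Unit using (tt)
open import Function using (_∘_; const)
open import Function.Bundles using (Equivalence)
open import Function.Definitions using (Injective)
open import Relation.Nullary using (¬_; Dec; yes; no; contradiction)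
open import Relation.Nullary.Decidable using (¬?; _×-dec_; decidable-stable)
open import Relation.Unary using (Decidable)
open import Relation.Binary using (DecidableEquality)
open import Relation.Binary.PropositionalEquality
  using (_≡_; _≢_; refl; sym; trans; cong; cong₂; subst; module ≡-Reasoning)

open Equivalence using (to; from)

private variable
  A B I : Set
  k m n r : ℕ

^-distribʳ-* : ∀ x y m → (x * y) ^ m ≡ x ^ m * y ^ m
^-distribʳ-* x y zero    = refl
^-distribʳ-* x y (suc m) = begin
  x * y * (x * y) ^ m       ≡⟨ cong (x * y *_) (^-distribʳ-* x y m) ⟩
  x * y * (x ^ m * y ^ m)   ≡⟨ solve 4 (λ x y u v → x :* y :* (u :* v) := x :* u :* (y :* v))
                                        refl x y (x ^ m) (y ^ m) ⟩
  x * x ^ m * (y * y ^ m)   ∎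
  where open ≡-Reasoning
        open +-*-Solver

m≤2*n*[m/n] : ∀ {m n} .{{_ : NonZero n}} → n ≤ m → m ≤ 2 * n * (m / n)
m≤2*n*[m/n] {m} {n} n≤m = begin
  m                      ≡⟨ m≡m%n+[m/n]*n m n ⟩
  m % n + m / n * n      ≤⟨ +-monoˡ-≤ (m / n * n) (≤-trans (m%n≤n m n) n≤[m/n]*n) ⟩
  m / n * n + m / n * n  ≡⟨ solve 2 (λ q n → q :* n :+ q :* n := con 2 :* n :* q) refl (m / n) n ⟩
  2 * n * (m / n)        ∎
  where
  open ≤-Reasoning
  open +-*-Solver
  n≤[m/n]*n : n ≤ m / n * n
  n≤[m/n]*n = subst (_≤ m / n * n) (*-identityˡ n) (*-monoˡ-≤ n (m≥n⇒m/n>0 n≤m))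

sum-map-mono : (is : List I) {f g : I → ℕ} → (∀ i → f i ≤ g i) →
               sum (List.map f is) ≤ sum (List.map g is)
sum-map-mono []       f≤g = z≤n
sum-map-mono (i ∷ is) f≤g = +-mono-≤ (f≤g i) (sum-map-mono is f≤g)

sum-map-mono-< : {is : List I} {f g : I → ℕ} → (∀ i → f i ≤ g i) →
                 Any (λ i → f i < g i) is → sum (List.map f is) < sum (List.map g is)
sum-map-mono-< f≤g (here {xs = is} fi<gi) = +-mono-<-≤ fi<gi (sum-map-mono is f≤g)
sum-map-mono-< f≤g (there {x = i} lt)     = +-mono-≤-< (f≤g i) (sum-map-mono-< f≤g lt)

sum-map-≤ : (is : List I) {f : I → ℕ} {c : ℕ} → (∀ i → f i ≤ c) →
            sum (List.map f is) ≤ length is * c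
sum-map-≤ []       f≤c = z≤n
sum-map-≤ (i ∷ is) f≤c = +-mono-≤ (f≤c i) (sum-map-≤ is f≤c)

sum-map-*ʳ : (is : List I) (f : I → ℕ) (c : ℕ) →
             sum (List.map f is) * c ≡ sum (List.map (λ i → f i * c) is)
sum-map-*ʳ []       f c = refl
sum-map-*ʳ (i ∷ is) f c =
  trans (*-distribʳ-+ c (f i) _) (cong (f i * c +_) (sum-map-*ʳ is f c))

module _ {P : A → Set} (P? : Decidable P) where

  length-filter-∷ : ∀ x xs → length (filter P? xs) ≤ length (filter P? (x ∷ xs))
  length-filter-∷ x xs with P? x
  ... | yes _ = n≤1+n _
  ... | no _  = ≤-refl

  length-filter-accept : ∀ {x} xs → P x → length (filter P? xs) < length (filter P? (x ∷ xs))
  length-filter-accept xs px rewrite Listₚ.filter-accept P? {xs = xs} px = ≤-refl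

length≤sum-filter : (P : I → A → Set) (P? : ∀ i → Decidable (P i)) (is : List I) (xs : List A) →
                    (∀ {x} → x ∈ xs → Any (λ i → P i x) is) →
                    length xs ≤ sum (List.map (λ i → length (filter (P? i) xs)) is)
length≤sum-filter P P? is []       covered = z≤n
length≤sum-filter P P? is (x ∷ xs) covered =
  ≤-<-trans (length≤sum-filter P P? is xs (covered ∘ there))
    (sum-map-mono-< (λ i → length-filter-∷ (P? i) x xs)
      (Any.map (length-filter-accept (P? _) xs) (covered (here refl))))

length≤fibres : (κ : A → B) (_≟_ : DecidableEquality B) (ys : List B) (xs : List A) {c : ℕ} →
                (∀ {x} → x ∈ xs → κ x ∈ ys) →
                (∀ y → length (filter (λ x → κ x ≟ y) xs) ≤ c) →
                length xs ≤ length ys * c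
length≤fibres κ _≟_ ys xs covered fibre≤c =
  ≤-trans (length≤sum-filter (λ y x → κ x ≡ y) (λ y x → κ x ≟ y) ys xs covered)
          (sum-map-≤ ys fibre≤c)

unique-constant⇒length≤1 : {xs : List A} → Unique xs → (∀ {x y} → x ∈ xs → y ∈ xs → x ≡ y) →
                           length xs ≤ 1
unique-constant⇒length≤1 {xs = []}         _                   _    = z≤n
unique-constant⇒length≤1 {xs = _ ∷ []}     _                   _    = ≤-refl
unique-constant⇒length≤1 {xs = _ ∷ _ ∷ _} ((x≢ All.∷ _) ∷ _) same =
  contradiction (same (here refl) (there (here refl))) x≢

length≤-injectiveOn : (κ : A → B) (_≟_ : DecidableEquality B) (ys : List B) {xs : List A} →
                      Unique xs → (∀ {x y} → x ∈ xs → y ∈ xs → κ x ≡ κ y → x ≡ y) →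
                      (∀ {x} → x ∈ xs → κ x ∈ ys) → length xs ≤ length ys
length≤-injectiveOn κ _≟_ ys {xs} unique injective covered =
  subst (length xs ≤_) (*-identityʳ (length ys)) (length≤fibres κ _≟_ ys xs covered fibre≤1)
  where
  fibre≤1 : ∀ y → length (filter (λ x → κ x ≟ y) xs) ≤ 1
  fibre≤1 y = unique-constant⇒length≤1 (Uniqueₚ.filter⁺ (λ x → κ x ≟ y) unique) λ x∈ z∈ →
    let x∈xs , κx≡y = ∈-filter⁻ (λ x → κ x ≟ y) x∈
        z∈xs , κz≡y = ∈-filter⁻ (λ x → κ x ≟ y) z∈
    in injective x∈xs z∈xs (trans κx≡y (sym κz≡y))

unique-map⁺-injectiveOn : (f : A → B) {xs : List A} → Unique xs →
                          (∀ {x y} → x ∈ xs → y ∈ xs → f x ≡ f y → x ≡ y) →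
                          Unique (List.map f xs)
unique-map⁺-injectiveOn f {[]}     _              _         = []
unique-map⁺-injectiveOn f {x ∷ xs} (x∉xs ∷ uniq) injective =
  Allₚ.map⁺ (All.tabulate λ y∈xs fx≡fy →
    All.lookup x∉xs y∈xs (injective (here refl) (there y∈xs) fx≡fy))
  ∷ unique-map⁺-injectiveOn f uniq (λ x∈ y∈ → injective (there x∈) (there y∈))

length-cartesianProductWith : {C : Set} (f : A → B → C) (xs : List A) (ys : List B) →
                              length (cartesianProductWith f xs ys) ≡ length xs * length ys
length-cartesianProductWith f []       ys = refl
length-cartesianProductWith f (x ∷ xs) ys =
  trans (Listₚ.length-++ (List.map (f x) ys))
        (cong₂ _+_ (Listₚ.length-map (f x) ys) (length-cartesianProductWith f xs ys))

allVecs : ∀ m r → List (Vec (Fin m) r)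
allVecs m zero    = [ [] ]
allVecs m (suc r) = cartesianProductWith _∷_ (allFin m) (allVecs m r)

∈-allVecs : (v : Vec (Fin m) r) → v ∈ allVecs m r
∈-allVecs []      = here refl
∈-allVecs (x ∷ v) = ∈-cartesianProductWith⁺ _∷_ (∈-allFin x) (∈-allVecs v)

allVecs-unique : ∀ m r → Unique (allVecs m r)
allVecs-unique m zero    = All.[] ∷ []
allVecs-unique m (suc r) =
  Uniqueₚ.cartesianProductWith⁺ _∷_ Vecₚ.∷-injective (Uniqueₚ.allFin⁺ m) (allVecs-unique m r)

length-allVecs : ∀ m r → length (allVecs m r) ≡ m ^ r
length-allVecs m zero    = refl
length-allVecs m (suc r) =
  trans (length-cartesianProductWith _∷_ (allFin m) (allVecs m r))
        (cong₂ _*_ (Listₚ.length-tabulate {n = m} (λ i → i)) (length-allVecs m r))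

_≟ᵥ_ : DecidableEquality (Vec (Fin n) m)
_≟ᵥ_ = Vecₚ.≡-dec Finₚ._≟_

take-++ : (xs : Vec A m) (ys : Vec A n) → take m (xs ++ ys) ≡ xs
take-++ {m = m} xs ys = Vecₚ.++-injectiveˡ _ xs (Vecₚ.take++drop≡id m (xs ++ ys))

drop-++ : (xs : Vec A m) (ys : Vec A n) → drop m (xs ++ ys) ≡ ys
drop-++ {m = m} xs ys = Vecₚ.++-injectiveʳ _ xs (Vecₚ.take++drop≡id m (xs ++ ys))

map-take++drop : (f : A → B) (xs : Vec A (m + n)) →
                 Vec.map f xs ≡ Vec.map f (take m xs) ++ Vec.map f (drop m xs)
map-take++drop {m = m} f xs =
  trans (cong (Vec.map f) (sym (Vecₚ.take++drop≡id m xs))) (Vecₚ.map-++ f (take m xs) (drop m xs))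

map-cong-lookup : {f g : A → B} (xs : Vec A m) →
                  (∀ i → f (lookup xs i) ≡ g (lookup xs i)) → Vec.map f xs ≡ Vec.map g xs
map-cong-lookup []       eq = refl
map-cong-lookup (x ∷ xs) eq = cong₂ _∷_ (eq zero) (map-cong-lookup xs (eq ∘ suc))

lookup-extensionality : (xs ys : Vec A m) → (∀ i → lookup xs i ≡ lookup ys i) → xs ≡ ys
lookup-extensionality xs ys eq =
  trans (sym (Vecₚ.tabulate∘lookup xs)) (trans (Vecₚ.tabulate-cong eq) (Vecₚ.tabulate∘lookup ys))

module _ (f : Fin m → Fin n) where

  extendAlong : (Fin m → A) → (Fin n → A) → Fin n → A
  extendAlong g d v with Finₚ.any? (λ i → f i Finₚ.≟ v)
  ... | yes (i , _) = g i
  ... | no _        = d v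

  extendAlong-image : Injective _≡_ _≡_ f → (g : Fin m → A) (d : Fin n → A) →
                      ∀ i → extendAlong g d (f i) ≡ g i
  extendAlong-image f-injective g d i with Finₚ.any? (λ i′ → f i′ Finₚ.≟ f i)
  ... | yes (i′ , fi′≡fi) = cong g (f-injective fi′≡fi)
  ... | no ∄i′            = contradiction (i , refl) ∄i′

  extendAlong-outside : (g : Fin m → A) (d : Fin n → A) {v : Fin n} →
                        ¬ (∃ λ i → f i ≡ v) → extendAlong g d v ≡ d v
  extendAlong-outside g d {v} ∄i with Finₚ.any? (λ i → f i Finₚ.≟ v)
  ... | yes found = contradiction found ∄i
  ... | no _      = refl

_⊆_ : Rel k r → Rel k r → Set
P ⊆ Q = ∀ x → T (P x) → T (Q x)

module _ {r₁ r₂} (P₁ Q₁ : Rel k r₁) (P₂ Q₂ : Rel k r₂)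
         (s : Vec (Fin k) r₁) (u : Vec (Fin k) r₂) where

  boxP-++ : boxP P₁ Q₁ P₂ Q₂ (s ++ u) ≡ (P₁ s ∧ Q₂ u) ∨ (Q₁ s ∧ P₂ u)
  boxP-++ rewrite take-++ s u | drop-++ s u = refl

  boxP-intro₁ : T (P₁ s) → T (Q₂ u) → T (boxP P₁ Q₁ P₂ Q₂ (s ++ u))
  boxP-intro₁ p q = subst T (sym boxP-++) (from T-∨ (inj₁ (from T-∧ (p , q))))

  boxP-intro₂ : T (Q₁ s) → T (P₂ u) → T (boxP P₁ Q₁ P₂ Q₂ (s ++ u))
  boxP-intro₂ q p = subst T (sym boxP-++) (from T-∨ (inj₂ (from T-∧ (q , p))))

  boxP-elim : T (boxP P₁ Q₁ P₂ Q₂ (s ++ u)) → (T (P₁ s) × T (Q₂ u)) ⊎ (T (Q₁ s) × T (P₂ u))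
  boxP-elim t = Sum.map (to T-∧) (to T-∧) (to T-∨ (subst T boxP-++ t))

  boxP⇒Q₁ : P₁ ⊆ Q₁ → T (boxP P₁ Q₁ P₂ Q₂ (s ++ u)) → T (Q₁ s)
  boxP⇒Q₁ P₁⊆Q₁ = Sum.[ P₁⊆Q₁ s ∘ proj₁ , proj₁ ] ∘ boxP-elim

  boxP⇒Q₂ : P₂ ⊆ Q₂ → T (boxP P₁ Q₁ P₂ Q₂ (s ++ u)) → T (Q₂ u)
  boxP⇒Q₂ P₂⊆Q₂ = Sum.[ proj₂ , P₂⊆Q₂ u ∘ proj₂ ] ∘ boxP-elim

  boxP⇒P₁ : ¬ T (P₂ u) → T (boxP P₁ Q₁ P₂ Q₂ (s ++ u)) → T (P₁ s)
  boxP⇒P₁ ¬p₂ = Sum.[ proj₁ , (λ (_ , p₂) → contradiction p₂ ¬p₂) ] ∘ boxP-elim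

  boxP-reject : ¬ T (P₁ s) → ¬ T (P₂ u) → ¬ T (boxP P₁ Q₁ P₂ Q₂ (s ++ u))
  boxP-reject ¬p₁ ¬p₂ = Sum.[ ¬p₁ ∘ proj₁ , ¬p₂ ∘ proj₂ ] ∘ boxP-elim

OR⊆Bin : OR {k} r ⊆ Bin r
OR⊆Bin x = proj₁ ∘ to T-∧

zeroIf : Dec A → Fin (2 + k)
zeroIf (yes _) = zero
zeroIf (no _)  = suc zero

mismatch : Vec (Fin m) r → Vec (Fin m) r → Vec (Fin (2 + k)) r
mismatch s t = tabulate λ i → zeroIf (lookup s i Finₚ.≟ lookup t i)

Bin-mismatch : (s t : Vec (Fin m) r) → T (Bin {k} r (mismatch s t))
Bin-mismatch []      []      = tt
Bin-mismatch (x ∷ s) (y ∷ t) with x Finₚ.≟ y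
... | yes _ = Bin-mismatch s t
... | no _  = Bin-mismatch s t

¬any-isOne-mismatch-self : (t : Vec (Fin m) r) → ¬ T (any isOne (toList (mismatch {k = k} t t)))
¬any-isOne-mismatch-self []      ()
¬any-isOne-mismatch-self (x ∷ t) with x Finₚ.≟ x
... | yes _  = ¬any-isOne-mismatch-self t
... | no x≢x = contradiction refl x≢x

any-isOne-mismatch : {s t : Vec (Fin m) r} → s ≢ t → T (any isOne (toList (mismatch {k = k} s t)))
any-isOne-mismatch {s = []}    {[]}    s≢t = s≢t refl
any-isOne-mismatch {s = x ∷ s} {y ∷ t} s≢t with x Finₚ.≟ y
... | yes refl = any-isOne-mismatch (s≢t ∘ cong (x ∷_))
... | no _     = tt

OR-mismatch : {s t : Vec (Fin m) r} → s ≢ t → T (OR {k} r (mismatch s t))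
OR-mismatch {s = s} {t} s≢t = from T-∧ (Bin-mismatch s t , any-isOne-mismatch s≢t)

¬OR-mismatch-self : (t : Vec (Fin m) r) → ¬ T (OR {k} r (mismatch t t))
¬OR-mismatch-self t = ¬any-isOne-mismatch-self t ∘ proj₂ ∘ to T-∧

BoundsNRD : Rel k r → Rel k r → ℕ → ℕ → Set
BoundsNRD {r = r} P Q n m = ∀ (H : Instance n r) → NonRedundant P Q H → length (edges H) ≤ m

Witness : Rel k r → Rel k r → (H : Instance n r) → Vec (Fin n) r → (Fin n → Fin k) → Set
Witness P Q H e ψ =
  (∀ e′ → e′ ∈ edges H → e′ ≢ e → T (P (Vec.map ψ e′)))
  × T (Q (Vec.map ψ e)) × ¬ T (P (Vec.map ψ e))

chooseWitnesses : {P Q : Rel (2 + k) r} {H : Instance n r} → NonRedundant P Q H →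
                  Σ (Vec (Fin n) r → Fin n → Fin (2 + k)) λ ψ →
                    ∀ {e} → e ∈ edges H → Witness P Q H e (ψ e)
chooseWitnesses {k = k} {r} {n} {P} {Q} {H} nonRedundant = ψ , witness
  where
  open DecMembership _≟ᵥ_ using (_∈?_)

  ψ : Vec (Fin n) r → Fin n → Fin (2 + k)
  ψ e with e ∈? edges H
  ... | yes e∈H = proj₁ (nonRedundant e e∈H)
  ... | no _    = const zero

  witness : ∀ {e} → e ∈ edges H → Witness P Q H e (ψ e)
  witness {e} e∈H with e ∈? edges H
  ... | yes e∈H′ = proj₂ (nonRedundant e e∈H′)
  ... | no e∉H   = contradiction e∈H e∉H

⊊⇒¬NonEmpty₀ : {P Q : Rel k 0} → P ⊊ Q → ¬ NonEmpty P
⊊⇒¬NonEmpty₀ (_ , [] , _ , ¬p) ([] , p) = ¬p p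

⊊⇒1≤NRD : {P Q : Rel (2 + k) r} → r ≤ n → P ⊊ Q → ∀ {a} → BoundsNRD P Q n a → 1 ≤ a
⊊⇒1≤NRD {k} {r} {n} {P} {Q} r≤n (_ , x , qx , ¬px) nrd≤a = nrd≤a single nonRedundant
  where
  ι : Fin r → Fin n
  ι i = inject≤ i r≤n

  ι-injective : Injective _≡_ _≡_ ι
  ι-injective = Finₚ.inject≤-injective r≤n r≤n _ _

  ψ : Fin n → Fin (2 + k)
  ψ = extendAlong ι (lookup x) (const zero)

  map-ψ-ι : Vec.map ψ (tabulate ι) ≡ x
  map-ψ-ι = begin
    Vec.map ψ (tabulate ι) ≡⟨ Vecₚ.tabulate-∘ ψ ι ⟨
    tabulate (ψ ∘ ι)       ≡⟨ Vecₚ.tabulate-cong (extendAlong-image ι ι-injective (lookup x) (const zero)) ⟩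
    tabulate (lookup x)    ≡⟨ Vecₚ.tabulate∘lookup x ⟩
    x                      ∎
    where open ≡-Reasoning

  single : Instance n r
  single = mkInstance [ tabulate ι ] (All.[] ∷ [])

  nonRedundant : NonRedundant P Q single
  nonRedundant _ (here refl) =
    ψ , (λ { _ (here refl) e≢e → contradiction refl e≢e }) ,
    subst (T ∘ Q) (sym map-ψ-ι) qx , ¬px ∘ subst (T ∘ P) map-ψ-ι

-- The upper bound

module UpperBound {k r n a : ℕ} (P Q : Rel (2 + k) r) (P⊆Q : P ⊆ Q) (nrd≤a : BoundsNRD P Q n a)
                  (G : Instance n (r + r))
                  (nonRedundant : NonRedundant (boxP P Q (OR r) (Bin r)) (Full (r + r)) G) where

  private
    R : Rel (2 + k) (r + r)
    R = boxP P Q (OR r) (Bin r)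

    E : List (Vec (Fin n) (r + r))
    E = edges G

    witnesses : Σ (Vec (Fin n) (r + r) → Fin n → Fin (2 + k)) λ ψ →
                  ∀ {g} → g ∈ E → Witness R (Full (r + r)) G g (ψ g)
    witnesses = chooseWitnesses {P = R} {Q = Full (r + r)} {H = G} nonRedundant

    ψ : Vec (Fin n) (r + r) → Fin n → Fin (2 + k)
    ψ = proj₁ witnesses

  pqPart orPart : (Fin n → Fin (2 + k)) → Vec (Fin n) (r + r) → Vec (Fin (2 + k)) r
  pqPart φ g = Vec.map φ (take r g)
  orPart φ g = Vec.map φ (drop r g)

  module _ {g g′} (g∈E : g ∈ E) (g′∈E : g′ ∈ E) (g′≢g : g′ ≢ g) where

    private
      accepts : T (R (pqPart (ψ g) g′ ++ orPart (ψ g) g′))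
      accepts = subst (T ∘ R) (map-take++drop {m = r} (ψ g) g′)
                      (proj₁ (proj₂ witnesses g∈E) g′ g′∈E g′≢g)

    accepts-Bin : T (Bin r (orPart (ψ g) g′))
    accepts-Bin = boxP⇒Q₂ P Q (OR r) (Bin r) (pqPart (ψ g) g′) (orPart (ψ g) g′) OR⊆Bin accepts

    accepts-Q : T (Q (pqPart (ψ g) g′))
    accepts-Q = boxP⇒Q₁ P Q (OR r) (Bin r) (pqPart (ψ g) g′) (orPart (ψ g) g′) P⊆Q accepts

    accepts-P : ¬ T (OR r (orPart (ψ g) g′)) → T (P (pqPart (ψ g) g′))
    accepts-P ¬or = boxP⇒P₁ P Q (OR r) (Bin r) (pqPart (ψ g) g′) (orPart (ψ g) g′) ¬or accepts

  module _ {g} (g∈E : g ∈ E) where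

    private
      rejects : ¬ T (R (pqPart (ψ g) g ++ orPart (ψ g) g))
      rejects = proj₂ (proj₂ (proj₂ witnesses g∈E)) ∘ subst (T ∘ R) (sym (map-take++drop {m = r} (ψ g) g))

    rejects-P : T (Bin r (orPart (ψ g) g)) → ¬ T (P (pqPart (ψ g) g))
    rejects-P bin p = rejects (boxP-intro₁ P Q (OR r) (Bin r) (pqPart (ψ g) g) (orPart (ψ g) g) p bin)

    rejects-OR : T (Q (pqPart (ψ g) g)) → ¬ T (OR r (orPart (ψ g) g))
    rejects-OR q or = rejects (boxP-intro₂ P Q (OR r) (Bin r) (pqPart (ψ g) g) (orPart (ψ g) g) q or)

  data Kind : Set where
    nonBoolean outsideQ insideQ : Kind

  HasKind : Kind → Vec (Fin n) (r + r) → Set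
  HasKind nonBoolean g = ¬ T (Bin r (orPart (ψ g) g))
  HasKind outsideQ   g = T (Bin r (orPart (ψ g) g)) × ¬ T (Q (pqPart (ψ g) g))
  HasKind insideQ    g = T (Bin r (orPart (ψ g) g)) × T (Q (pqPart (ψ g) g))

  hasKind? : ∀ κ → Decidable (HasKind κ)
  hasKind? nonBoolean g = ¬? (T? _)
  hasKind? outsideQ   g = T? _ ×-dec ¬? (T? _)
  hasKind? insideQ    g = T? _ ×-dec T? _

  kinds : List Kind
  kinds = nonBoolean ∷ outsideQ ∷ insideQ ∷ []

  kindOf : ∀ g → Any (λ κ → HasKind κ g) kinds
  kindOf g with T? (Bin r (orPart (ψ g) g)) | T? (Q (pqPart (ψ g) g))
  ... | no ¬bin | _     = here ¬bin
  ... | yes bin | no ¬q = there (here (bin , ¬q))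
  ... | yes bin | yes q = there (there (here (bin , q)))

  edgesOfKind : Kind → List (Vec (Fin n) (r + r))
  edgesOfKind κ = filter (hasKind? κ) E

  ∈-edgesOfKind⁻ : ∀ κ {g} → g ∈ edgesOfKind κ → g ∈ E × HasKind κ g
  ∈-edgesOfKind⁻ κ = ∈-filter⁻ (hasKind? κ)

  edgesOfKind-unique : ∀ κ → Unique (edgesOfKind κ)
  edgesOfKind-unique κ = Uniqueₚ.filter⁺ (hasKind? κ) (distinct G)

  byContradiction : {g g′ : Vec (Fin n) (r + r)} → ¬ (g′ ≢ g) → g ≡ g′
  byContradiction = sym ∘ decidable-stable (_ ≟ᵥ _)

  drop-injectiveOn-nonBoolean : ∀ {g g′} → g ∈ edgesOfKind nonBoolean → g′ ∈ edgesOfKind nonBoolean →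
                                drop r g ≡ drop r g′ → g ≡ g′
  drop-injectiveOn-nonBoolean {g} g∈ g′∈ drop≡ = byContradiction λ g′≢g →
    let g∈E , ¬bin = ∈-edgesOfKind⁻ nonBoolean g∈ in
    ¬bin (subst (λ u → T (Bin r (Vec.map (ψ g) u))) (sym drop≡)
                (accepts-Bin g∈E (proj₁ (∈-edgesOfKind⁻ nonBoolean g′∈)) g′≢g))

  take-injectiveOn-outsideQ : ∀ {g g′} → g ∈ edgesOfKind outsideQ → g′ ∈ edgesOfKind outsideQ →
                              take r g ≡ take r g′ → g ≡ g′
  take-injectiveOn-outsideQ {g} g∈ g′∈ take≡ = byContradiction λ g′≢g →
    let g∈E , _ , ¬q = ∈-edgesOfKind⁻ outsideQ g∈ in
    ¬q (subst (λ s → T (Q (Vec.map (ψ g) s))) (sym take≡)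
              (accepts-Q g∈E (proj₁ (∈-edgesOfKind⁻ outsideQ g′∈)) g′≢g))

  nonBoolean-count : length (edgesOfKind nonBoolean) ≤ n ^ r
  nonBoolean-count = subst (length (edgesOfKind nonBoolean) ≤_) (length-allVecs n r)
    (length≤-injectiveOn (drop r) _≟ᵥ_ (allVecs n r)
      (edgesOfKind-unique nonBoolean) drop-injectiveOn-nonBoolean (λ _ → ∈-allVecs _))

  outsideQ-count : length (edgesOfKind outsideQ) ≤ n ^ r
  outsideQ-count = subst (length (edgesOfKind outsideQ) ≤_) (length-allVecs n r)
    (length≤-injectiveOn (take r) _≟ᵥ_ (allVecs n r)
      (edgesOfKind-unique outsideQ) take-injectiveOn-outsideQ (λ _ → ∈-allVecs _))

  module Slice (f : Vec (Fin n) r) where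

    slice : List (Vec (Fin n) (r + r))
    slice = filter (λ g → drop r g ≟ᵥ f) (edgesOfKind insideQ)

    ∈-slice⁻ : ∀ {g} → g ∈ slice → g ∈ E × HasKind insideQ g × drop r g ≡ f
    ∈-slice⁻ g∈ =
      let g∈insideQ , drop≡f = ∈-filter⁻ (λ g → drop r g ≟ᵥ f) g∈
          g∈E , insideQ-g    = ∈-edgesOfKind⁻ insideQ g∈insideQ
      in g∈E , insideQ-g , drop≡f

    same-drop : ∀ {g g′} → g ∈ slice → g′ ∈ slice → drop r g ≡ drop r g′
    same-drop g∈ g′∈ = trans (proj₂ (proj₂ (∈-slice⁻ g∈))) (sym (proj₂ (proj₂ (∈-slice⁻ g′∈))))

    take-injectiveOn-slice : ∀ {g g′} → g ∈ slice → g′ ∈ slice → take r g ≡ take r g′ → g ≡ g′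
    take-injectiveOn-slice {g} {g′} g∈ g′∈ take≡ = begin
      g                      ≡⟨ Vecₚ.take++drop≡id r g ⟨
      take r g ++ drop r g   ≡⟨ cong₂ _++_ take≡ (same-drop g∈ g′∈) ⟩
      take r g′ ++ drop r g′ ≡⟨ Vecₚ.take++drop≡id r g′ ⟩
      g′                     ∎
      where open ≡-Reasoning

    sliceInstance : Instance n r
    sliceInstance = mkInstance (List.map (take r) slice)
      (unique-map⁺-injectiveOn (take r) (Uniqueₚ.filter⁺ _ (edgesOfKind-unique insideQ)) take-injectiveOn-slice)

    slice-nonRedundant : NonRedundant P Q sliceInstance
    slice-nonRedundant e e∈ with ∈-map⁻ (take r) e∈
    ... | g , g∈ , refl with ∈-slice⁻ g∈
    ...   | g∈E , (bin , q) , _ = ψ g , accepted , q , rejects-P g∈E bin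
      where
      accepted : ∀ e′ → e′ ∈ List.map (take r) slice → e′ ≢ take r g → T (P (Vec.map (ψ g) e′))
      accepted e′ e′∈ e′≢ with ∈-map⁻ (take r) e′∈
      ... | g′ , g′∈ , refl = accepts-P g∈E (proj₁ (∈-slice⁻ g′∈)) (e′≢ ∘ cong (take r))
        (subst (λ u → ¬ T (OR r (Vec.map (ψ g) u))) (same-drop g∈ g′∈) (rejects-OR g∈E q))

    slice-count : length slice ≤ a
    slice-count = subst (_≤ a) (Listₚ.length-map (take r) slice) (nrd≤a sliceInstance slice-nonRedundant)

  insideQ-count : length (edgesOfKind insideQ) ≤ n ^ r * a
  insideQ-count = subst (λ N → length (edgesOfKind insideQ) ≤ N * a) (length-allVecs n r)
    (length≤fibres (drop r) _≟ᵥ_ (allVecs n r) (edgesOfKind insideQ) (λ _ → ∈-allVecs _)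
      Slice.slice-count)

  edges-count : length E ≤ (2 + a) * n ^ r
  edges-count = begin
    length E
      ≤⟨ length≤sum-filter HasKind hasKind? kinds E (λ {g} _ → kindOf g) ⟩
    length (edgesOfKind nonBoolean) + (length (edgesOfKind outsideQ) + (length (edgesOfKind insideQ) + 0))
      ≤⟨ +-mono-≤ nonBoolean-count (+-mono-≤ outsideQ-count (+-mono-≤ insideQ-count ≤-refl)) ⟩
    n ^ r + (n ^ r + (n ^ r * a + 0))
      ≡⟨ solve 2 (λ x y → x :+ (x :+ (x :* y :+ con 0)) := (con 2 :+ y) :* x) refl (n ^ r) a ⟩
    (2 + a) * n ^ r ∎
    where open ≤-Reasoning
          open +-*-Solver

boxNRD≤3*NRD*n^r : (P Q : Rel (2 + k) r) → r ≤ n → P ⊊ Q → ∀ {a b} → BoundsNRD P Q n a →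
                   IsNRD (boxP P Q (OR r) (Bin r)) (Full (r + r)) n b → b ≤ 3 * (a * n ^ r)
boxNRD≤3*NRD*n^r {r = r} {n} P Q r≤n P⊊Q {a} nrd≤a ((G , nonRedundant , refl) , _) = begin
  length (edges G)    ≤⟨ UpperBound.edges-count P Q (proj₁ P⊊Q) nrd≤a G nonRedundant ⟩
  (2 + a) * n ^ r     ≤⟨ *-monoˡ-≤ (n ^ r) (+-monoˡ-≤ a (+-mono-≤ 1≤a 1≤a)) ⟩
  (a + a + a) * n ^ r ≡⟨ solve 2 (λ a x → (a :+ a :+ a) :* x := con 3 :* (a :* x)) refl a (n ^ r) ⟩
  3 * (a * n ^ r)     ∎
  where
  open ≤-Reasoning
  open +-*-Solver
  1≤a : 1 ≤ a
  1≤a = ⊊⇒1≤NRD r≤n P⊊Q nrd≤a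

-- The lower bound

module Grid {r L n : ℕ} (fits : suc r * (r * L) ≤ n) where

  cell : Fin (suc r) → Fin (r * L) → Fin n
  cell j w = inject≤ (combine j w) fits

  cell-injective : ∀ {j j′ w w′} → cell j w ≡ cell j′ w′ → j ≡ j′ × w ≡ w′
  cell-injective eq = Finₚ.combine-injective _ _ _ _ (Finₚ.inject≤-injective fits fits _ _ eq)

-- Vertex cell j (combine i s) is the s-th vertex of block i of group j.
module LowerBound {k r n L : ℕ} (P Q : Rel (2 + k) r)
                  (cell : Fin (suc r) → Fin (r * L) → Fin n)
                  (cell-injective : ∀ {j j′ w w′} → cell j w ≡ cell j′ w′ → j ≡ j′ × w ≡ w′) where

  private
    R : Rel (2 + k) (r + r)
    R = boxP P Q (OR r) (Bin r)

  InGroup : Fin (suc r) → Fin n → Set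
  InGroup j v = ∃ λ w → cell j w ≡ v

  inGroup? : ∀ j → Decidable (InGroup j)
  inGroup? j v = Finₚ.any? λ w → cell j w Finₚ.≟ v

  Avoids : Fin (suc r) → Vec (Fin n) r → Set
  Avoids j e = ∀ i → ¬ InGroup j (lookup e i)

  avoids? : ∀ j → Decidable (Avoids j)
  avoids? j e = Finₚ.all? λ i → ¬? (inGroup? j (lookup e i))

  hits : ∀ {j} e → ¬ Avoids j e → ∃ λ i → InGroup j (lookup e i)
  hits {j} e ¬avoids =
    let i , ¬¬inGroup = Finₚ.¬∀⟶∃¬ r _ (λ i → ¬? (inGroup? j (lookup e i))) ¬avoids
    in i , decidable-stable (inGroup? j (lookup e i)) ¬¬inGroup

  ¬hitsEveryGroup : ∀ e → ¬ (∀ j → ¬ Avoids j e)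
  ¬hitsEveryGroup e hitsEvery =
    let j₁ , j₂ , j₁<j₂ , samePosition = Finₚ.pigeonhole (n<1+n r) (proj₁ ∘ hit)
        _ , w₁ , cell≡₁ = hit j₁
        _ , w₂ , cell≡₂ = hit j₂
    in Finₚ.<⇒≢ j₁<j₂ (proj₁ (cell-injective
         (trans cell≡₁ (trans (cong (lookup e) samePosition) (sym cell≡₂)))))
    where
    hit : ∀ j → ∃ λ i → InGroup j (lookup e i)
    hit j = hits e (hitsEvery j)

  avoidsSome : ∀ e → Any (λ j → Avoids j e) (allFin (suc r))
  avoidsSome e with Finₚ.any? (λ j → avoids? j e)
  ... | yes (j , avoids) = lose (∈-allFin j) avoids
  ... | no none          = contradiction (λ j avoids → none (j , avoids)) (¬hitsEveryGroup e)

  slots : Fin (suc r) → Vec (Fin L) r → Vec (Fin n) r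
  slots j t = tabulate λ i → cell j (combine i (lookup t i))

  slots-injective : ∀ j {t t′} → slots j t ≡ slots j t′ → t ≡ t′
  slots-injective j {t} {t′} eq = lookup-extensionality t t′ λ i →
    proj₂ (Finₚ.combine-injective i _ i _ (proj₂ (cell-injective (begin
      cell j (combine i (lookup t i))  ≡⟨ Vecₚ.lookup∘tabulate _ i ⟨
      lookup (slots j t) i             ≡⟨ cong (λ v → lookup v i) eq ⟩
      lookup (slots j t′) i            ≡⟨ Vecₚ.lookup∘tabulate _ i ⟩
      cell j (combine i (lookup t′ i)) ∎))))
    where open ≡-Reasoning

  mark : Vec (Fin L) r → Fin r → Fin L → Fin (2 + k)
  mark t i s = zeroIf (s Finₚ.≟ lookup t i)

  blowUpWitness : Fin (suc r) → (Fin n → Fin (2 + k)) → Vec (Fin L) r → Fin n → Fin (2 + k)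
  blowUpWitness j ψ t = extendAlong (cell j) (uncurry (mark t) ∘ remQuot L) ψ

  map-blowUpWitness-slots : ∀ j ψ t t′ → Vec.map (blowUpWitness j ψ t) (slots j t′) ≡ mismatch t′ t
  map-blowUpWitness-slots j ψ t t′ =
    trans (sym (Vecₚ.tabulate-∘ _ _)) (Vecₚ.tabulate-cong λ i →
      trans (extendAlong-image (cell j) (proj₂ ∘ cell-injective) (uncurry (mark t) ∘ remQuot L) ψ _)
            (cong (uncurry (mark t)) (Finₚ.remQuot-combine i (lookup t′ i))))

  map-blowUpWitness-avoiding : ∀ {j e} ψ t → Avoids j e → Vec.map (blowUpWitness j ψ t) e ≡ Vec.map ψ e
  map-blowUpWitness-avoiding {j} {e} ψ t avoids =
    map-cong-lookup e λ i → extendAlong-outside (cell j) (uncurry (mark t) ∘ remQuot L) ψ (avoids i)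

  module BlowUp (H : Instance n r) (nonRedundant : NonRedundant P Q H) (j : Fin (suc r)) where

    avoiding : List (Vec (Fin n) r)
    avoiding = filter (avoids? j) (edges H)

    blowUp : Instance n (r + r)
    blowUp = mkInstance (cartesianProductWith _++_ avoiding (List.map (slots j) (allVecs L r)))
      (Uniqueₚ.cartesianProductWith⁺ _++_ (λ {w} {x} → Vecₚ.++-injective w x)
        (Uniqueₚ.filter⁺ (avoids? j) (distinct H)) (Uniqueₚ.map⁺ (slots-injective j) (allVecs-unique L r)))

    length-blowUp : length (edges blowUp) ≡ length avoiding * L ^ r
    length-blowUp = trans (length-cartesianProductWith _++_ avoiding _)
      (cong (length avoiding *_) (trans (Listₚ.length-map (slots j) (allVecs L r)) (length-allVecs L r)))

    module _ {e} (e∈ : e ∈ avoiding) (t : Vec (Fin L) r) where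

      private
        e∈H : e ∈ edges H
        e∈H = proj₁ (∈-filter⁻ (avoids? j) {xs = edges H} e∈)

        e-avoids : Avoids j e
        e-avoids = proj₂ (∈-filter⁻ (avoids? j) {xs = edges H} e∈)

        ψ : Fin n → Fin (2 + k)
        ψ = proj₁ (nonRedundant e e∈H)

        φ : Fin n → Fin (2 + k)
        φ = blowUpWitness j ψ t

        image : ∀ {e′} → Avoids j e′ → ∀ t′ →
                Vec.map φ (e′ ++ slots j t′) ≡ Vec.map ψ e′ ++ mismatch t′ t
        image {e′} avoids t′ = trans (Vecₚ.map-++ φ e′ (slots j t′))
          (cong₂ _++_ (map-blowUpWitness-avoiding ψ t avoids) (map-blowUpWitness-slots j ψ t t′))

        accepts : ∀ {e′} → e′ ∈ avoiding → ∀ t′ → e′ ++ slots j t′ ≢ e ++ slots j t →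
                  T (R (Vec.map φ (e′ ++ slots j t′)))
        accepts {e′} e′∈ t′ g′≢g with ∈-filter⁻ (avoids? j) {xs = edges H} e′∈ | e′ ≟ᵥ e
        ... | e′∈H , avoids | no e′≢e = subst (T ∘ R) (sym (image avoids t′))
          (boxP-intro₁ P Q (OR r) (Bin r) _ _ (proj₁ (proj₂ (nonRedundant e e∈H)) e′ e′∈H e′≢e)
            (Bin-mismatch t′ t))
        ... | _ , avoids | yes refl = subst (T ∘ R) (sym (image avoids t′))
          (boxP-intro₂ P Q (OR r) (Bin r) _ _ (proj₁ (proj₂ (proj₂ (nonRedundant e e∈H))))
            (OR-mismatch {s = t′} {t} (g′≢g ∘ cong (λ t″ → e ++ slots j t″))))

        rejects : ¬ T (R (Vec.map φ (e ++ slots j t)))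
        rejects = boxP-reject P Q (OR r) (Bin r) _ _ (proj₂ (proj₂ (proj₂ (nonRedundant e e∈H))))
                    (¬OR-mismatch-self t)
                ∘ subst (T ∘ R) (image e-avoids t)

      blowUp-witness : Σ (Fin n → Fin (2 + k)) (Witness R (Full (r + r)) blowUp (e ++ slots j t))
      blowUp-witness = φ , accepted , tt , rejects
        where
        accepted : ∀ g′ → g′ ∈ edges blowUp → g′ ≢ e ++ slots j t → T (R (Vec.map φ g′))
        accepted g′ g′∈ g′≢g with ∈-cartesianProductWith⁻ _++_ avoiding _ g′∈
        ... | e′ , f′ , e′∈ , f′∈ , refl with ∈-map⁻ (slots j) f′∈
        ...   | t′ , _ , refl = accepts e′∈ t′ g′≢g

    blowUp-nonRedundant : NonRedundant R (Full (r + r)) blowUp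
    blowUp-nonRedundant g g∈ with ∈-cartesianProductWith⁻ _++_ avoiding _ g∈
    ... | e , f , e∈ , f∈ , refl with ∈-map⁻ (slots j) f∈
    ...   | t , _ , refl = blowUp-witness e∈ t

  edges-count : (H : Instance n r) → NonRedundant P Q H → ∀ {b} → BoundsNRD R (Full (r + r)) n b →
                length (edges H) * L ^ r ≤ suc r * b
  edges-count H nonRedundant {b} nrd≤b = begin
    length (edges H) * L ^ r
      ≤⟨ *-monoˡ-≤ (L ^ r) covered ⟩
    sum (List.map avoidCount (allFin (suc r))) * L ^ r
      ≡⟨ sum-map-*ʳ (allFin (suc r)) avoidCount (L ^ r) ⟩
    sum (List.map (λ j → avoidCount j * L ^ r) (allFin (suc r)))
      ≤⟨ sum-map-≤ (allFin (suc r)) blowUp-count ⟩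
    length (allFin (suc r)) * b
      ≡⟨ cong (_* b) (Listₚ.length-tabulate {n = suc r} (λ j → j)) ⟩
    suc r * b ∎
    where
    open ≤-Reasoning

    avoidCount : Fin (suc r) → ℕ
    avoidCount j = length (BlowUp.avoiding H nonRedundant j)

    covered : length (edges H) ≤ sum (List.map avoidCount (allFin (suc r)))
    covered = length≤sum-filter Avoids avoids? (allFin (suc r)) (edges H) (λ {e} _ → avoidsSome e)

    blowUp-count : ∀ j → avoidCount j * L ^ r ≤ b
    blowUp-count j = let open BlowUp H nonRedundant j in
      subst (_≤ b) length-blowUp (nrd≤b blowUp blowUp-nonRedundant)

NRD*n^r≤C*boxNRD : (P Q : Rel (2 + k) r) .{{_ : NonZero r}} → suc r * r ≤ n → ∀ {a b} →
                   IsNRD P Q n a → BoundsNRD (boxP P Q (OR r) (Bin r)) (Full (r + r)) n b →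
                   a * n ^ r ≤ (2 * (suc r * r)) ^ r * suc r * b
NRD*n^r≤C*boxNRD {r = r} {n} P Q M≤n {b = b} ((H , nonRedundant , refl) , _) nrd≤b = begin
  a * n ^ r                    ≤⟨ *-monoʳ-≤ a (^-monoˡ-≤ r (m≤2*n*[m/n] M≤n)) ⟩
  a * (2 * M * L) ^ r          ≡⟨ cong (a *_) (^-distribʳ-* (2 * M) L r) ⟩
  a * ((2 * M) ^ r * L ^ r)    ≡⟨ solve 3 (λ a x y → a :* (x :* y) := x :* (a :* y)) refl a ((2 * M) ^ r) (L ^ r) ⟩
  (2 * M) ^ r * (a * L ^ r)    ≤⟨ *-monoʳ-≤ ((2 * M) ^ r) blown-up ⟩
  (2 * M) ^ r * (suc r * b)    ≡⟨ *-assoc ((2 * M) ^ r) (suc r) b ⟨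
  (2 * M) ^ r * suc r * b      ∎
  where
  open ≤-Reasoning
  open +-*-Solver
  M L a : ℕ
  M = suc r * r
  instance
    M-nonZero : NonZero M
    M-nonZero = m*n≢0 (suc r) r
  L = n / M
  a = length (edges H)
  fits : suc r * (r * L) ≤ n
  fits = subst (_≤ n) (trans (*-comm L M) (*-assoc (suc r) r L)) (m/n*n≤m n M)
  blown-up : a * L ^ r ≤ suc r * b
  blown-up = LowerBound.edges-count P Q (Grid.cell fits) (Grid.cell-injective fits) H nonRedundant nrd≤b

theoremB1 : ∀ (r : ℕ) → ∃ λ (C : ℕ) → ∃ λ (n₀ : ℕ) →
    ∀ (k : ℕ) (P Q : Rel (2 + k) r) → P ⊊ Q → NonEmpty P →
    ∀ (n : ℕ) → n₀ ≤ n → ∀ (a b : ℕ) →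
    IsNRD P Q n a →
    IsNRD (boxP P Q (OR r) (Bin r)) (Full (r + r)) n b →
    (a * n ^ r ≤ C * b) × (b ≤ C * (a * n ^ r))
-- Nonemptiness of P is used only to rule out arity 0, where D^0 has a single tuple.
theoremB1 zero    = 0 , 0 , λ k P Q P⊊Q nonEmpty → contradiction nonEmpty (⊊⇒¬NonEmpty₀ P⊊Q)
theoremB1 r@(suc _) = 3 + C , suc r * r , λ k P Q P⊊Q _ n M≤n a b nrdA nrdB →
    ≤-trans (NRD*n^r≤C*boxNRD P Q M≤n nrdA (proj₂ nrdB)) (*-monoˡ-≤ b (m≤n+m C 3)) ,
    ≤-trans (boxNRD≤3*NRD*n^r P Q (≤-trans (m≤n*m r (suc r)) M≤n) P⊊Q (proj₂ nrdA) nrdB)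
            (*-monoˡ-≤ (a * n ^ r) (m≤m+n 3 C))
  where
  C : ℕ
  C = (2 * (suc r * r)) ^ r * suc r
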